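{- Let $a,b$ be positive integers, $A=(a,a)$, $B=(b,b)$, and let $(S(i))_{i\ge0}$ be the ordered Markov sequences for $A$ and $B$. Let $n>1$ and $1\le i\le 2^{n-1}$ be integers, and set $k'=6\cdot2^{n-2}+i-1$ and $k''=6\cdot2^{n-2}-i+1$. Then \[ \frac{|S(k'+1)|}{2}-d_{k'+1}=d_{k''}, \] where $|X|$ is the length of $X$ and $d_m$ is Stern's diatomic sequence.
   Context: For finite sequences $X,Y$, $X\oplus Y$ denotes concatenation. For a triple $(X,Y,Z)$ of finite sequences put $\mathcal{L}(X,Y,Z)=(X,X\oplus Y,Y)$ and $\mathcal{R}(X,Y,Z)=(Y,Y\oplus Z,Z)$. Let $v=(A,A\oplus B,B)$. For $m\ge1$ the $2^m$ triples at depth $m$ are $\varepsilon_m(\cdots\varepsilon_1(v)\cdots)$ for words $(\varepsilon_1,\ldots,\varepsilon_m)\in\{\mathcal{L},\mathcal{R}\}^m$ ($\varepsilon_1$ applied first), listed in lexicographic order with $\mathcal{L}<\mathcal{R}$. The ordered Markov sequences are $S(0)=A$, $S(1)=B$, $S(2)=A\oplus B$, and for $m\ge1$, $1\le i\le2^m$, $S(2^m+i)$ is the middle component of the $i$-th triple at depth $m$. Stern's diatomic sequence: $d_0=0$, $d_1=1$, $d_{2n}=d_n$, $d_{2n-1}=d_n+d_{n-1}$ for $n\ge1$. -}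

module Defs where

open import Data.Nat using (ℕ; zero; suc; _+_; _*_; _∸_; _^_; _%_; _≡ᵇ_; ⌊_/2⌋)
open import Data.Bool using (if_then_else_)
open import Data.List using (List; []; _∷_; _++_; map; concat)
open import Data.Product using (_×_; _,_)

Seq : Set
Seq = List ℕ

Triple : Set
Triple = Seq × Seq × Seq

𝓛 : Triple → Triple
𝓛 (X , Y , Z) = (X , X ++ Y , Y)

𝓡 : Triple → Triple
𝓡 (X , Y , Z) = (Y , Y ++ Z , Z)

middle : Triple → Seq
middle (X , Y , Z) = Y

-- The triples ε_m(⋯ε_1(t)⋯) for all words of length m, in lexicographic
-- order (𝓛 < 𝓡), ε_1 applied first (hence most significant).
level : ℕ → Triple → List Triple
level zero    t = t ∷ []
level (suc m) t = level m (𝓛 t) ++ level m (𝓡 t)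

oneTo : ℕ → List ℕ
oneTo zero    = []
oneTo (suc m) = oneTo m ++ (suc m ∷ [])

-- The list S(0), S(1), …, S(2^(m+1)) of ordered Markov sequences.
markovPrefix : Seq → Seq → ℕ → List Seq
markovPrefix A B m =
  A ∷ B ∷ (A ++ B) ∷
  concat (map (λ d → map middle (level d (A , A ++ B , B))) (oneTo m))

nthOr : {X : Set} → X → List X → ℕ → X
nthOr x₀ []       _       = x₀
nthOr x₀ (x ∷ xs) zero    = x
nthOr x₀ (x ∷ xs) (suc k) = nthOr x₀ xs k

-- Ordered Markov sequence S(k) for A, B (k < 2^(k+1)+1, so index is in range).
S : Seq → Seq → ℕ → Seq
S A B k = nthOr [] (markovPrefix A B k) k

-- Stern's diatomic sequence: d 0 = 0, d 1 = 1, d (2n) = d n,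
-- d (2n-1) = d n + d (n-1).  Computed with fuel (fuel n suffices).
sternF : ℕ → ℕ → ℕ
sternF zero    _               = 0
sternF (suc f) zero            = 0
sternF (suc f) (suc zero)      = 1
sternF (suc f) (suc (suc m)) =
  if (m % 2) ≡ᵇ 0
  then sternF f (suc ⌊ m /2⌋)
  else sternF f (suc ⌊ m /2⌋) + sternF f (suc (suc ⌊ m /2⌋))

stern : ℕ → ℕ
stern n = sternF n n

-- Call a triple (X, Y, Z) labelled N (at scale c) when |X| = c·d_N, |Z| = c·d_{N+1} and
-- |Y| = |X| + |Z|. Because d_{2N} = d_N and d_{2N+1} = d_N + d_{N+1}, 𝓛 and 𝓡 turn label N
-- into 2N and 2N+1, and v is labelled 1 when |A| = |B| = c. Hence the i-th triple at depth m
-- is labelled 2^m + i - 1, and |S(k+1)| = c·(d_k + d_{k+1}) for every k; only |A| = |B| = 2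
-- matters, not the positivity of a and b. With c = 2 the left-hand side is therefore d_{k′},
-- and k′, k″ are mirror images in the block [2^n, 2^(n+1)], on which d is symmetric:
-- d(2^m + s) = d(2^m + t) whenever s + t = 2^m.
module Submission where

open import Defs
open import Data.Bool using (true; false)
open import Data.Empty using (⊥-elim)
open import Data.Nat
  using (ℕ; zero; suc; _+_; _*_; _∸_; _^_; _%_; _≡ᵇ_; ⌊_/2⌋; ⌈_/2⌉; _≤_; _<_; z≤n; s≤s; s<s; z<s)
open import Data.Nat.Properties
open import Data.Nat.DivMod using (m*n%n≡0; [m+kn]%n≡m%n)
open import Data.Nat.Tactic.RingSolver using (solve-∀)
open import Data.List using (List; _∷_; []; _++_; length; map; concat; applyUpTo)
open import Data.List.Properties using (map-++; map-∘; concat-++; ++-assoc; ++-identityʳ; length-++)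
open import Data.Product using (_,_)
open import Data.Integer using (+_)
import Data.Integer as ℤ
open import Data.Integer.Properties using (pos-+; pos-*)
import Data.Integer.Tactic.RingSolver as ℤ-Solver
open import Data.Rational using (_/_; _-_; toℚᵘ; fromℚᵘ)
import Data.Rational as ℚ
open import Data.Rational.Properties using (toℚᵘ-injective; toℚᵘ-homo-+; toℚᵘ-homo‿-; toℚᵘ-fromℚᵘ)
import Data.Rational.Unnormalised as ℚᵘ
open import Data.Rational.Unnormalised.Properties using (+-cong; -‿cong; ≃-trans; ≃-sym; module ≃-Reasoning)
open import Function using (_∘_)
open import Relation.Binary.PropositionalEquality

private variable X Y : Set

sternF-fuel-independent : ∀ {f g} n → n ≤ f → n ≤ g → sternF f n ≡ sternF g n
sternF-fuel-independent {zero}  {zero}  zero _ _ = refl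
sternF-fuel-independent {zero}  {suc g} zero _ _ = refl
sternF-fuel-independent {suc f} {zero}  zero _ _ = refl
sternF-fuel-independent {suc f} {suc g} zero _ _ = refl
sternF-fuel-independent {suc f} {suc g} 1 _ _ = refl
sternF-fuel-independent {suc f} {suc g} 2 (s≤s 1≤f) (s≤s 1≤g) = sternF-fuel-independent 1 1≤f 1≤g
sternF-fuel-independent {suc f} {suc g} (suc (suc (suc m))) (s≤s m+2≤f) (s≤s m+2≤g)
  with suc m % 2 ≡ᵇ 0
... | true  = sternF-fuel-independent _ (≤-trans half≤ m+2≤f) (≤-trans half≤ m+2≤g)
  where half≤ : suc ⌊ suc m /2⌋ ≤ suc (suc m)
        half≤ = s≤s (⌊n/2⌋≤n (suc m))
... | false = cong₂ _+_ (sternF-fuel-independent _ (≤-trans half≤ m+2≤f) (≤-trans half≤ m+2≤g))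
                        (sternF-fuel-independent _ (≤-trans half< m+2≤f) (≤-trans half< m+2≤g))
  where half≤ : suc ⌊ suc m /2⌋ ≤ suc (suc m)
        half≤ = s≤s (⌊n/2⌋≤n (suc m))
        half< : suc (suc ⌊ suc m /2⌋) ≤ suc (suc m)
        half< = s≤s (⌊n/2⌋<n m)

double%2≡0 : ∀ n → 2 * n % 2 ≡ 0
double%2≡0 n = trans (cong (_% 2) (*-comm 2 n)) (m*n%n≡0 n 2)

1+double%2≡1 : ∀ n → suc (2 * n) % 2 ≡ 1
1+double%2≡1 n = trans (cong (λ x → suc x % 2) (*-comm 2 n)) ([m+kn]%n≡m%n 1 n 2)

⌊double/2⌋≡n : ∀ n → ⌊ 2 * n /2⌋ ≡ n
⌊double/2⌋≡n n = trans (cong (λ x → ⌊ n + x /2⌋) (+-identityʳ n)) (sym (n≡⌊n+n/2⌋ n))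

⌊1+double/2⌋≡n : ∀ n → ⌊ suc (2 * n) /2⌋ ≡ n
⌊1+double/2⌋≡n n = trans (cong (λ x → ⌈ n + x /2⌉) (+-identityʳ n)) (sym (n≡⌈n+n/2⌉ n))

stern-even : ∀ n → stern (2 * n) ≡ stern n
stern-even zero = refl
stern-even (suc n) rewrite *-suc 2 n | double%2≡0 n | ⌊double/2⌋≡n n =
  sternF-fuel-independent (suc n) (s≤s (m≤m+n n _)) ≤-refl

stern-odd : ∀ n → stern (1 + 2 * n) ≡ stern n + stern (1 + n)
stern-odd zero = refl
stern-odd (suc n) = trans (cong (stern ∘ suc) (*-suc 2 n)) unfolded
  where
    unfolded : stern (3 + 2 * n) ≡ stern (suc n) + stern (2 + n)
    unfolded rewrite 1+double%2≡1 n | ⌊1+double/2⌋≡n n =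
      cong₂ _+_ (sternF-fuel-independent (suc n) (s≤s (m≤n⇒m≤1+n (m≤m+n n _))) ≤-refl)
                (sternF-fuel-independent (2 + n) (s≤s (s≤s (m≤m+n n _))) ≤-refl)

data Halves : ℕ → Set where
  even : ∀ h → Halves (2 * h)
  odd  : ∀ h → Halves (1 + 2 * h)

halves : ∀ n → Halves n
halves zero = even 0
halves (suc n) with halves n
... | even h = odd h
... | odd h  = subst Halves (*-suc 2 h) (even (suc h))

odd≢even : ∀ a b → 1 + 2 * a ≢ 2 * b
odd≢even a b eq = 1≢0 (trans (sym (1+double%2≡1 a)) (trans (cong (_% 2) eq) (double%2≡0 b)))
  where 1≢0 : 1 ≢ 0
        1≢0 ()

stern-even-shift : ∀ P h → stern (2 * P + 2 * h) ≡ stern (P + h)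
stern-even-shift P h = trans (cong stern (sym (*-distribˡ-+ 2 P h))) (stern-even (P + h))

stern-odd-shift : ∀ P h → stern (2 * P + (1 + 2 * h)) ≡ stern (P + h) + stern (P + suc h)
stern-odd-shift P h = begin
  stern (2 * P + (1 + 2 * h))         ≡⟨ cong stern (+-suc (2 * P) (2 * h)) ⟩
  stern (1 + (2 * P + 2 * h))         ≡⟨ cong (stern ∘ suc) (sym (*-distribˡ-+ 2 P h)) ⟩
  stern (1 + 2 * (P + h))             ≡⟨ stern-odd (P + h) ⟩
  stern (P + h) + stern (1 + (P + h)) ≡⟨ cong (λ x → stern (P + h) + stern x) (sym (+-suc P h)) ⟩
  stern (P + h) + stern (P + suc h)   ∎
  where open ≡-Reasoning

stern-reflect : ∀ m {s t} → s + t ≡ 2 ^ m → stern (2 ^ m + s) ≡ stern (2 ^ m + t)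
stern-reflect zero {0} {1} _ = refl
stern-reflect zero {1} {0} _ = refl
stern-reflect zero {0} {0} ()
stern-reflect zero {0} {suc (suc _)} ()
stern-reflect zero {1} {suc _} ()
stern-reflect zero {suc (suc _)} ()
stern-reflect (suc m) {s} {t} s+t≡2P with halves s | halves t
... | even h | even h′ = begin
    stern (2 * P + 2 * h)   ≡⟨ stern-even-shift P h ⟩
    stern (P + h)           ≡⟨ stern-reflect m (*-cancelˡ-≡ _ _ 2 (trans (*-distribˡ-+ 2 h h′) s+t≡2P)) ⟩
    stern (P + h′)          ≡⟨ sym (stern-even-shift P h′) ⟩
    stern (2 * P + 2 * h′)  ∎
  where P = 2 ^ m
        open ≡-Reasoning
... | even h | odd h′  = ⊥-elim (odd≢even (h + h′) (2 ^ m) (trans (even+odd h h′) s+t≡2P))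
  where even+odd : ∀ a b → 1 + 2 * (a + b) ≡ 2 * a + (1 + 2 * b)
        even+odd = solve-∀
... | odd h  | even h′ = ⊥-elim (odd≢even (h + h′) (2 ^ m) (trans (odd+even h h′) s+t≡2P))
  where odd+even : ∀ a b → 1 + 2 * (a + b) ≡ (1 + 2 * a) + 2 * b
        odd+even = solve-∀
... | odd h  | odd h′  = begin
    stern (2 * P + (1 + 2 * h))         ≡⟨ stern-odd-shift P h ⟩
    stern (P + h) + stern (P + suc h)   ≡⟨ cong₂ _+_ (stern-reflect m h+1+h′≡P) (stern-reflect m 1+h+h′≡P) ⟩
    stern (P + suc h′) + stern (P + h′) ≡⟨ +-comm (stern (P + suc h′)) (stern (P + h′)) ⟩
    stern (P + h′) + stern (P + suc h′) ≡⟨ sym (stern-odd-shift P h′) ⟩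
    stern (2 * P + (1 + 2 * h′))        ∎
  where
    open ≡-Reasoning
    P = 2 ^ m
    odd+odd : ∀ a b → 2 * (1 + a + b) ≡ (1 + 2 * a) + (1 + 2 * b)
    odd+odd = solve-∀
    1+h+h′≡P : 1 + h + h′ ≡ P
    1+h+h′≡P = *-cancelˡ-≡ _ _ 2 (trans (odd+odd h h′) s+t≡2P)
    h+1+h′≡P : h + suc h′ ≡ P
    h+1+h′≡P = trans (+-suc h h′) 1+h+h′≡P

n<2^n : ∀ n → n < 2 ^ n
n<2^n zero    = z<s
n<2^n (suc n) = +-mono-≤ (m^n>0 2 n) (≤-trans (n<2^n n) (m≤m+n (2 ^ n) 0))

applyUpTo-cong : ∀ {f g : ℕ → X} n → (∀ j → f j ≡ g j) → applyUpTo f n ≡ applyUpTo g n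
applyUpTo-cong zero    f≗g = refl
applyUpTo-cong (suc n) f≗g = cong₂ _∷_ (f≗g 0) (applyUpTo-cong n (f≗g ∘ suc))

applyUpTo-++ : ∀ (f : ℕ → X) m n → applyUpTo f (m + n) ≡ applyUpTo f m ++ applyUpTo (λ j → f (m + j)) n
applyUpTo-++ f zero    n = refl
applyUpTo-++ f (suc m) n = cong (f 0 ∷_) (applyUpTo-++ (f ∘ suc) m n)

nthOr-map : ∀ (f : X → Y) x xs k → nthOr (f x) (map f xs) k ≡ f (nthOr x xs k)
nthOr-map f x []       k       = refl
nthOr-map f x (y ∷ xs) zero    = refl
nthOr-map f x (y ∷ xs) (suc k) = nthOr-map f x xs k

nthOr-applyUpTo : ∀ (x : X) f {n k} → k < n → nthOr x (applyUpTo f n) k ≡ f k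
nthOr-applyUpTo x f {suc n} {zero}  _         = refl
nthOr-applyUpTo x f {suc n} {suc k} (s<s k<n) = nthOr-applyUpTo x (f ∘ suc) k<n

markovLength : ℕ → ℕ → ℕ
markovLength c k = c * (stern k + stern (suc k))

data SternLabelled (c N : ℕ) : Triple → Set where
  labelled : ∀ {X Y Z} → length X ≡ c * stern N → length Z ≡ c * stern (suc N) →
             length Y ≡ length X + length Z → SternLabelled c N (X , Y , Z)

middle-length : ∀ {c N t} → SternLabelled c N t → length (middle t) ≡ markovLength c N
middle-length {c} (labelled |X| |Z| |Y|) = trans |Y| (trans (cong₂ _+_ |X| |Z|) (sym (*-distribˡ-+ c _ _)))

middle-length-odd : ∀ {c N t} → SternLabelled c N t → length (middle t) ≡ c * stern (1 + 2 * N)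
middle-length-odd {c} {N} lab = trans (middle-length lab) (cong (c *_) (sym (stern-odd N)))

𝓛-labelled : ∀ {c N t} → SternLabelled c N t → SternLabelled c (2 * N) (𝓛 t)
𝓛-labelled {c} {N} lab@(labelled {X} |X| _ _) =
  labelled (trans |X| (cong (c *_) (sym (stern-even N)))) (middle-length-odd lab) (length-++ X)

𝓡-labelled : ∀ {c N t} → SternLabelled c N t → SternLabelled c (1 + 2 * N) (𝓡 t)
𝓡-labelled {c} {N} lab@(labelled {Y = Y} _ |Z| _) =
  labelled (middle-length-odd lab)
           (trans |Z| (cong (c *_) (trans (sym (stern-even (suc N))) (cong stern (*-suc 2 N)))))
           (length-++ Y)

level-middle-lengths : ∀ {c N} m {t} → SternLabelled c N t →
  map (length ∘ middle) (level m t) ≡ applyUpTo (λ j → markovLength c (2 ^ m * N + j)) (2 ^ m)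
level-middle-lengths {c} {N} zero lab =
  cong (_∷ []) (trans (middle-length lab) (cong (markovLength c) (sym 1*N+0≡N)))
  where 1*N+0≡N : 1 * N + 0 ≡ N
        1*N+0≡N = trans (+-identityʳ _) (*-identityˡ N)
level-middle-lengths {c} {N} (suc m) {t} lab = begin
    map (length ∘ middle) (level m (𝓛 t) ++ level m (𝓡 t))
  ≡⟨ map-++ (length ∘ middle) (level m (𝓛 t)) _ ⟩
    map (length ∘ middle) (level m (𝓛 t)) ++ map (length ∘ middle) (level m (𝓡 t))
  ≡⟨ cong₂ _++_ (level-middle-lengths m (𝓛-labelled lab))
                (level-middle-lengths m (𝓡-labelled lab)) ⟩
    applyUpTo (λ j → ℓ (P * (2 * N) + j)) P ++ applyUpTo (λ j → ℓ (P * (1 + 2 * N) + j)) P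
  ≡⟨ cong₂ _++_ (applyUpTo-cong P (λ j → cong ℓ (left-index P N j)))
                (applyUpTo-cong P (λ j → cong ℓ (right-index P N j))) ⟩
    applyUpTo (λ j → ℓ (2 * P * N + j)) P ++ applyUpTo (λ j → ℓ (2 * P * N + (P + j))) P
  ≡⟨ applyUpTo-++ (λ j → ℓ (2 * P * N + j)) P P ⟨
    applyUpTo (λ j → ℓ (2 * P * N + j)) (P + P)
  ≡⟨ cong (applyUpTo _) (cong (λ x → P + x) (sym (+-identityʳ P))) ⟩
    applyUpTo (λ j → ℓ (2 * P * N + j)) (2 * P)
  ∎
  where
    open ≡-Reasoning
    P = 2 ^ m
    ℓ = markovLength c
    left-index : ∀ P N j → P * (2 * N) + j ≡ 2 * P * N + j
    left-index = solve-∀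
    right-index : ∀ P N j → P * (1 + 2 * N) + j ≡ 2 * P * N + (P + j)
    right-index = solve-∀

module _ {A B : Seq} {c : ℕ} (|A|≡c : length A ≡ c) (|B|≡c : length B ≡ c) where

  private
    ℓ : ℕ → ℕ
    ℓ = markovLength c

    depth : ℕ → List Seq
    depth d = map middle (level d (A , A ++ B , B))

  root-labelled : SternLabelled c 1 (A , A ++ B , B)
  root-labelled = labelled (trans |A|≡c (sym (*-identityʳ c))) (trans |B|≡c (sym (*-identityʳ c))) (length-++ A)

  depth-lengths : ∀ d → map length (depth d) ≡ applyUpTo (λ j → ℓ (2 ^ d + j)) (2 ^ d)
  depth-lengths d = begin
      map length (depth d)
    ≡⟨ map-∘ (level d _) ⟨
      map (length ∘ middle) (level d _)
    ≡⟨ level-middle-lengths d root-labelled ⟩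
      applyUpTo (λ j → ℓ (2 ^ d * 1 + j)) (2 ^ d)
    ≡⟨ applyUpTo-cong (2 ^ d) (λ j → cong (λ x → ℓ (x + j)) (*-identityʳ (2 ^ d))) ⟩
      applyUpTo (λ j → ℓ (2 ^ d + j)) (2 ^ d)
    ∎
    where open ≡-Reasoning

  depths-lengths : ∀ M →
    applyUpTo ℓ 2 ++ map length (concat (map depth (oneTo M))) ≡ applyUpTo ℓ (2 ^ suc M)
  depths-lengths zero    = refl
  depths-lengths (suc M) = begin
      applyUpTo ℓ 2 ++ map length (concat (map depth (oneTo M ++ suc M ∷ [])))
    ≡⟨ cong (λ ds → applyUpTo ℓ 2 ++ map length ds) concat-snoc ⟩
      applyUpTo ℓ 2 ++ map length (concat (map depth (oneTo M)) ++ depth (suc M))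
    ≡⟨ cong (applyUpTo ℓ 2 ++_) (map-++ length (concat (map depth (oneTo M))) _) ⟩
      applyUpTo ℓ 2 ++ (map length (concat (map depth (oneTo M))) ++ map length (depth (suc M)))
    ≡⟨ ++-assoc (applyUpTo ℓ 2) (map length (concat (map depth (oneTo M)))) (map length (depth (suc M))) ⟨
      (applyUpTo ℓ 2 ++ map length (concat (map depth (oneTo M)))) ++ map length (depth (suc M))
    ≡⟨ cong₂ _++_ (depths-lengths M) (depth-lengths (suc M)) ⟩
      applyUpTo ℓ P ++ applyUpTo (λ j → ℓ (P + j)) P
    ≡⟨ applyUpTo-++ ℓ P P ⟨
      applyUpTo ℓ (P + P)
    ≡⟨ cong (applyUpTo ℓ) (cong (λ x → P + x) (sym (+-identityʳ P))) ⟩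
      applyUpTo ℓ (2 * P)
    ∎
    where
      open ≡-Reasoning
      P = 2 ^ suc M
      concat-snoc : concat (map depth (oneTo M ++ suc M ∷ [])) ≡ concat (map depth (oneTo M)) ++ depth (suc M)
      concat-snoc = begin
          concat (map depth (oneTo M ++ suc M ∷ []))
        ≡⟨ cong concat (map-++ depth (oneTo M) _) ⟩
          concat (map depth (oneTo M) ++ depth (suc M) ∷ [])
        ≡⟨ concat-++ (map depth (oneTo M)) _ ⟨
          concat (map depth (oneTo M)) ++ (depth (suc M) ++ [])
        ≡⟨ cong (concat (map depth (oneTo M)) ++_) (++-identityʳ (depth (suc M))) ⟩
          concat (map depth (oneTo M)) ++ depth (suc M)
        ∎

  markovPrefix-lengths : ∀ M → map length (markovPrefix A B M) ≡ c ∷ applyUpTo ℓ (2 ^ suc M)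
  markovPrefix-lengths M =
    cong₂ _∷_ |A|≡c (trans (cong₂ _∷_ |B|≡ℓ0 (cong (_∷ map length (concat (map depth (oneTo M)))) |A++B|≡ℓ1)) (depths-lengths M))
    where
      |B|≡ℓ0 : length B ≡ ℓ 0
      |B|≡ℓ0 = trans |B|≡c (sym (*-identityʳ c))
      |A++B|≡ℓ1 : length (A ++ B) ≡ ℓ 1
      |A++B|≡ℓ1 = trans (length-++ A) (trans (cong₂ _+_ |A|≡c |B|≡c) (trans (cong (λ x → c + x) (sym (+-identityʳ c))) (*-comm 2 c)))

  length-S : ∀ k → length (S A B (suc k)) ≡ markovLength c k
  length-S k = begin
      length (nthOr [] (markovPrefix A B (suc k)) (suc k))
    ≡⟨ nthOr-map length [] (markovPrefix A B (suc k)) (suc k) ⟨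
      nthOr 0 (map length (markovPrefix A B (suc k))) (suc k)
    ≡⟨ cong (λ ℓs → nthOr 0 ℓs (suc k)) (markovPrefix-lengths (suc k)) ⟩
      nthOr 0 (applyUpTo ℓ (2 ^ (2 + k))) k
    ≡⟨ nthOr-applyUpTo 0 ℓ (<-≤-trans (n<2^n k) (^-monoʳ-≤ 2 (m≤n+m k 2))) ⟩
      ℓ k
    ∎
    where open ≡-Reasoning

half-of-double-sum-minus : ∀ x y → (+ (2 * (x + y))) / 2 - (+ y) / 1 ≡ (+ x) / 1
half-of-double-sum-minus x y = toℚᵘ-injective (begin
    toℚᵘ (fromℚᵘ p - fromℚᵘ q)               ≈⟨ toℚᵘ-homo-+ (fromℚᵘ p) (ℚ.- fromℚᵘ q) ⟩
    toℚᵘ (fromℚᵘ p) ℚᵘ.+ toℚᵘ (ℚ.- fromℚᵘ q)  ≈⟨ +-cong (toℚᵘ-fromℚᵘ p) (≃-trans (toℚᵘ-homo‿- (fromℚᵘ q)) (-‿cong (toℚᵘ-fromℚᵘ q))) ⟩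
    p ℚᵘ.+ ℚᵘ.- q                            ≈⟨ ℚᵘ.*≡* cross-multiplied ⟩
    r                                        ≈⟨ ≃-sym (toℚᵘ-fromℚᵘ r) ⟩
    toℚᵘ (fromℚᵘ r)                          ∎)
  where
    open ≃-Reasoning
    p = ℚᵘ.mkℚᵘ (+ (2 * (x + y))) 1
    q = ℚᵘ.mkℚᵘ (+ y) 0
    r = ℚᵘ.mkℚᵘ (+ x) 0
    2[x+y] : + (2 * (x + y)) ≡ + 2 ℤ.* (+ x ℤ.+ + y)
    2[x+y] = trans (pos-* 2 (x + y)) (cong (+ 2 ℤ.*_) (pos-+ x y))
    identity : ∀ X Y → (+ 2 ℤ.* (X ℤ.+ Y) ℤ.* + 1 ℤ.+ ℤ.- Y ℤ.* + 2) ℤ.* + 1 ≡ X ℤ.* (+ 2 ℤ.* + 1)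
    identity = ℤ-Solver.solve-∀
    cross-multiplied : (+ (2 * (x + y)) ℤ.* + 1 ℤ.+ ℤ.- (+ y) ℤ.* + 2) ℤ.* + 1 ≡ + x ℤ.* (+ 2 ℤ.* + 1)
    cross-multiplied = trans (cong (λ z → (z ℤ.* + 1 ℤ.+ ℤ.- (+ y) ℤ.* + 2) ℤ.* + 1) 2[x+y]) (identity (+ x) (+ y))

stern-reflect-6·2^p : ∀ p i → suc i ≤ 2 ^ suc p → stern (6 * 2 ^ p + suc i ∸ 1) ≡ stern (6 * 2 ^ p ∸ suc i + 1)
stern-reflect-6·2^p p i 1+i≤2P with m≤n⇒∃[o]m+o≡n 1+i≤2P
... | t , 1+i+t≡2P = begin
    stern (6 * P + suc i ∸ 1)      ≡⟨ cong stern k′≡ ⟩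
    stern (4P + (2 * P + i))       ≡⟨ stern-reflect (2 + p) offsets-sum ⟩
    stern (4P + suc t)             ≡⟨ cong stern k″≡ ⟨
    stern (6 * P ∸ suc i + 1)      ∎
  where
    open ≡-Reasoning
    P = 2 ^ p
    4P = 2 * (2 * P)
    k′≡ : 6 * P + suc i ∸ 1 ≡ 4P + (2 * P + i)
    k′≡ = trans (cong (_∸ 1) (+-suc (6 * P) i)) (k′-identity P i)
      where k′-identity : ∀ P i → 6 * P + i ≡ 2 * (2 * P) + (2 * P + i)
            k′-identity = solve-∀
    k″≡ : 6 * P ∸ suc i + 1 ≡ 4P + suc t
    k″≡ = begin
        6 * P ∸ suc i + 1                   ≡⟨ cong (λ x → x ∸ suc i + 1) (six-split P) ⟩
        2 * P + 4P ∸ suc i + 1              ≡⟨ cong (λ x → x + 4P ∸ suc i + 1) 1+i+t≡2P ⟨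
        suc i + t + 4P ∸ suc i + 1          ≡⟨ cong (λ x → x ∸ suc i + 1) (+-assoc (suc i) t 4P) ⟩
        suc i + (t + 4P) ∸ suc i + 1        ≡⟨ cong (_+ 1) (m+n∸m≡n (suc i) (t + 4P)) ⟩
        t + 4P + 1                          ≡⟨ k″-identity t 4P ⟩
        4P + suc t                          ∎
      where six-split : ∀ P → 6 * P ≡ 2 * P + 2 * (2 * P)
            six-split = solve-∀
            k″-identity : ∀ t Q → t + Q + 1 ≡ Q + suc t
            k″-identity = solve-∀
    offsets-sum : 2 * P + i + suc t ≡ 4P
    offsets-sum = begin
        2 * P + i + suc t          ≡⟨ regroup (2 * P) i t ⟩
        2 * P + (suc i + t)        ≡⟨ cong (λ x → 2 * P + x) 1+i+t≡2P ⟩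
        2 * P + 2 * P              ≡⟨ cong (λ x → 2 * P + x) (+-identityʳ (2 * P)) ⟨
        4P                         ∎
      where regroup : ∀ Q i t → Q + i + suc t ≡ Q + (suc i + t)
            regroup = solve-∀

lemma2p14 : (a b : ℕ) → 1 ≤ a → 1 ≤ b → (n i : ℕ) → 1 < n → 1 ≤ i → i ≤ 2 ^ (n ∸ 1) →
    let k′ = 6 * 2 ^ (n ∸ 2) + i ∸ 1
        k″ = 6 * 2 ^ (n ∸ 2) ∸ i + 1
    in ((+ length (S (a ∷ a ∷ []) (b ∷ b ∷ []) (k′ + 1))) / 2) - ((+ stern (k′ + 1)) / 1)
       ≡ (+ stern k″) / 1
lemma2p14 a b _ _ (suc (suc p)) (suc i) (s≤s (s≤s z≤n)) _ 1+i≤2P = begin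
    (+ length (S A B (k′ + 1))) / 2 - (+ stern (k′ + 1)) / 1
  ≡⟨ cong (λ k → (+ length (S A B k)) / 2 - (+ stern k) / 1) (+-comm k′ 1) ⟩
    (+ length (S A B (suc k′))) / 2 - (+ stern (suc k′)) / 1
  ≡⟨ cong (λ ℓ → (+ ℓ) / 2 - (+ stern (suc k′)) / 1) (length-S refl refl k′) ⟩
    (+ (2 * (stern k′ + stern (suc k′)))) / 2 - (+ stern (suc k′)) / 1
  ≡⟨ half-of-double-sum-minus (stern k′) (stern (suc k′)) ⟩
    (+ stern k′) / 1
  ≡⟨ cong (λ d → (+ d) / 1) (stern-reflect-6·2^p p i 1+i≤2P) ⟩
    (+ stern k″) / 1
  ∎
  where
    A = a ∷ a ∷ []
    B = b ∷ b ∷ []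
    k′ = 6 * 2 ^ p + suc i ∸ 1
    k″ = 6 * 2 ^ p ∸ suc i + 1
    open ≡-Reasoning
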